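{- Let $n\geq 4$ be an integer, and let $\mathbf{d}=(n,n)\in\mathbb{Z}_+^2$ and $\mathbf{t}=(5,3,2,\ldots,2)\in\mathbb{Z}_+^{n-2}$ (entries $5$, $3$, followed by $n-4$ entries equal to $2$). Then the pair $(\mathbf{d};\mathbf{t})$ is realizable, i.e., it is the degree sequence of a geographic plan.
   Context: Graphs are finite and undirected, with loops and multiple edges allowed; a loop contributes $2$ to the degree of its vertex. A map is an embedding of a connected graph $G=(V,E)$ in a compact surface without boundary such that edges meet only at common endpoints and every connected component of the complement of the image (a country) is homeomorphic to an open disk. The dual graph $G^*$ has the countries as vertices and the same edge set $E$: each edge joins the one or two countries on whose boundary it lies. A plan is a pair $(G,H)$ of graphs with a common edge set; it is geographic if there is a map of $G$ such that $H$ is its dual graph $G^*$ (with the given identification of edges). If $G$ has degree sequence $\mathbf{d}$ and $H$ has degree sequence $\mathbf{t}$ (up to ordering), then $(\mathbf{d};\mathbf{t})$ is the degree sequence of the plan. A pair $(\mathbf{d};\mathbf{t})$ is realizable if it is the degree sequence of some geographic plan. -}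

module Defs where

open import Data.Nat using (ℕ; _+_)
open import Data.Fin using (Fin; _≟_)
open import Data.Product using (Σ; ∃; _×_; _,_; proj₁; proj₂)
open import Data.Sum using (_⊎_)
open import Data.List using (List; map; allFin)
open import Data.Nat.ListAction using (sum)
open import Data.List.Relation.Binary.Permutation.Propositional using (_↭_)
open import Relation.Nullary using (¬_; does)
open import Data.Bool using (if_then_else_)
open import Relation.Binary.PropositionalEquality using (_≡_)
open import Function.Bundles using (_↔_; Inverse)
open import Function.Base using (_∘_)

-- Finite graphs (loops and multiple edges allowed) with edge set Fin E.
-- Each edge has an (ordered, but only used up to swapping) pair of ends.

record Graph (E : ℕ) : Set where
  field
    V    : ℕ
    ends : Fin E → Fin V × Fin V

open Graph public

[_≟′_] : ∀ {k} → Fin k → Fin k → ℕ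
[ x ≟′ y ] = if does (x ≟ y) then 1 else 0

-- degree: number of edge-ends at v (a loop contributes 2)
deg : ∀ {E} (G : Graph E) → Fin (V G) → ℕ
deg {E} G v =
  sum (map (λ e → [ proj₁ (ends G e) ≟′ v ] + [ proj₂ (ends G e) ≟′ v ]) (allFin E))

degSeq : ∀ {E} (G : Graph E) → List ℕ
degSeq G = map (deg G) (allFin (V G))

EdgeIso : ∀ {E} → Graph E → Graph E → Set
EdgeIso {E} G H =
  Σ (Fin (V G) ↔ Fin (V H)) λ φ →
    ∀ e → let f = Inverse.to φ in
      (ends H e ≡ (f (proj₁ (ends G e)) , f (proj₂ (ends G e))))
      ⊎ (ends H e ≡ (f (proj₂ (ends G e)) , f (proj₁ (ends G e))))

-- Combinatorial maps (flag systems): the standard combinatorial model of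
-- cellular embeddings of connected graphs in compact surfaces without
-- boundary (orientable or not).

data Orb2 {m : ℕ} (a b : Fin m → Fin m) : Fin m → Fin m → Set where
  here : ∀ {f} → Orb2 a b f f
  viaA : ∀ {f g} → Orb2 a b (a f) g → Orb2 a b f g
  viaB : ∀ {f g} → Orb2 a b (b f) g → Orb2 a b f g

data Orb3 {m : ℕ} (a b c : Fin m → Fin m) : Fin m → Fin m → Set where
  here : ∀ {f} → Orb3 a b c f f
  viaA : ∀ {f g} → Orb3 a b c (a f) g → Orb3 a b c f g
  viaB : ∀ {f g} → Orb3 a b c (b f) g → Orb3 a b c f g
  viaC : ∀ {f g} → Orb3 a b c (c f) g → Orb3 a b c f g

record Map (E : ℕ) : Set where
  field
    m  : ℕ
    s0 s1 s2 : Fin m → Fin m    -- s0: change vertex, s1: change edge, s2: change face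
    s0-inv : ∀ f → s0 (s0 f) ≡ f
    s1-inv : ∀ f → s1 (s1 f) ≡ f
    s2-inv : ∀ f → s2 (s2 f) ≡ f
    s0-free : ∀ f → ¬ (s0 f ≡ f)
    s1-free : ∀ f → ¬ (s1 f ≡ f)
    s2-free : ∀ f → ¬ (s2 f ≡ f)
    s02-comm : ∀ f → s0 (s2 f) ≡ s2 (s0 f)
    s02-free : ∀ f → ¬ (s0 (s2 f) ≡ f)
    connected : ∀ f g → Orb3 s0 s1 s2 f g
    nV nF : ℕ
    vtx : Fin m → Fin nV
    edg : Fin m → Fin E
    fac : Fin m → Fin nF
    vtx-orb : ∀ f g → (vtx f ≡ vtx g → Orb2 s1 s2 f g) × (Orb2 s1 s2 f g → vtx f ≡ vtx g)
    edg-orb : ∀ f g → (edg f ≡ edg g → Orb2 s0 s2 f g) × (Orb2 s0 s2 f g → edg f ≡ edg g)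
    fac-orb : ∀ f g → (fac f ≡ fac g → Orb2 s0 s1 f g) × (Orb2 s0 s1 f g → fac f ≡ fac g)
    vtx-surj : ∀ v → ∃ λ f → vtx f ≡ v
    edg-surj : ∀ e → ∃ λ f → edg f ≡ e
    fac-surj : ∀ c → ∃ λ f → fac f ≡ c

open Map public

edgeFlag : ∀ {E} (M : Map E) → Fin E → Fin (m M)
edgeFlag M e = proj₁ (edg-surj M e)

mapGraph : ∀ {E} → Map E → Graph E
mapGraph M = record
  { V = nV M
  ; ends = λ e → vtx M (edgeFlag M e) , vtx M (s0 M (edgeFlag M e)) }

dualGraph : ∀ {E} → Map E → Graph E
dualGraph M = record
  { V = nF M
  ; ends = λ e → fac M (edgeFlag M e) , fac M (s2 M (edgeFlag M e)) }

record Plan : Set where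
  field
    E : ℕ
    G H : Graph E

Geographic : Plan → Set
Geographic P = Σ (Map (Plan.E P)) λ M →
  EdgeIso (mapGraph M) (Plan.G P) × EdgeIso (dualGraph M) (Plan.H P)

HasDegSeq : Plan → List ℕ → List ℕ → Set
HasDegSeq P d t = (degSeq (Plan.G P) ↭ d) × (degSeq (Plan.H P) ↭ t)

Realizable : List ℕ → List ℕ → Set
Realizable d t = Σ Plan λ P → Geographic P × HasDegSeq P d t

{-# OPTIONS --safe #-}
-- For n = k + 4 take the graph with two vertices U and W, a loop LU at U, a loop LW at W,
-- and k + 2 parallel edges B, A₀, …, A_k joining U and W, so that U and W have degree k + 4.
-- Embed it so that consecutive edges Aⱼ, Aⱼ₊₁ bound the k digons and the two remaining
-- countries are a pentagon (LU on both of its sides, LW, B, A₀) and a triangle (LW, B, A_k).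
-- The embedding is given by its flags and the three involutions σ₀, σ₁, σ₂ of a flag system;
-- each vertex, edge and country is labelled explicitly and shown to be a single orbit by
-- walking every flag to a representative, and the degrees are counted edge by edge. (The
-- surface is the Klein bottle: χ = 2 − (k + 4) + (k + 2) = 0, and σ₁ agrees with σ₀σ₂ on a
-- flag of LU, which is impossible in an orientable map.)
module Submission where

open import Defs
open import Data.Nat using (ℕ; zero; suc; _+_; _*_; _≤_; _∸_; s≤s; z≤n)
open import Data.Nat.Properties using (+-0-commutativeMonoid)
open import Data.Bool using (Bool; true; false; not)
open import Data.Bool.Properties using (not-involutive; not-¬)
open import Data.Fin using (Fin; zero; suc; fromℕ; inject₁)
open import Data.Fin.Patterns using (0F; 1F; 2F)
open import Data.Fin.Properties using (+↔⊎; *↔×; 2↔Bool)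
open import Data.Fin.Induction using (<-weakInduction)
open import Data.Fin.Relation.Unary.Top
  using (View; ‵fromℕ; ‵inject₁; view; view-fromℕ; view-inject₁; view-unique)
open import Data.Product using (∃; _×_; _,_; proj₁; proj₂)
open import Data.Product.Function.NonDependent.Propositional using (_×-↔_)
open import Data.Sum using (_⊎_; inj₁; inj₂)
open import Data.List using (List; _∷_; []; replicate; tabulate; map; allFin)
open import Data.List.Properties using (map-cong; map-tabulate)
open import Data.Nat.ListAction using (sum)
open import Data.List.Relation.Binary.Permutation.Propositional using (_↭_; ↭-reflexive)
open import Algebra.Properties.CommutativeMonoid.Sum +-0-commutativeMonoid
  using (sum-syntax; sum-cong-≗; ∑-distrib-+; sum-init-last; sum-replicate-zero)
open import Function.Base using (_∘_; id)
open import Function.Bundles using (_↔_; Inverse)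
open import Function.Construct.Composition using (_↔-∘_)
open import Function.Construct.Identity using (↔-id)
open import Function.Construct.Symmetry using (↔-sym)
open import Relation.Binary.PropositionalEquality
  using (_≡_; _≢_; refl; sym; trans; cong; cong₂; subst; subst₂; module ≡-Reasoning)

sum-tabulate : ∀ {n} (f : Fin n → ℕ) → sum (tabulate f) ≡ ∑[ i < n ] f i
sum-tabulate {zero}  f = refl
sum-tabulate {suc n} f = cong (f zero +_) (sum-tabulate (f ∘ suc))

sum-allFin : ∀ {n} (f : Fin n → ℕ) → sum (map f (allFin n)) ≡ ∑[ i < n ] f i
sum-allFin f = trans (cong sum (map-tabulate id f)) (sum-tabulate f)

∑-ones : ∀ n → ∑[ i < n ] 1 ≡ n
∑-ones zero    = refl
∑-ones (suc n) = cong suc (∑-ones n)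

∑-indicator : ∀ {n} (j : Fin n) → ∑[ i < n ] [ i ≟′ j ] ≡ 1
∑-indicator {suc n} zero    = cong suc (sum-replicate-zero n)
∑-indicator {suc n} (suc j) = ∑-indicator j

tabulate-const : ∀ {A : Set} n (x : A) → tabulate {n = n} (λ _ → x) ≡ replicate n x
tabulate-const zero    x = refl
tabulate-const (suc n) x = cong (x ∷_) (tabulate-const n x)

data Walk₂ {X : Set} (a b : X → X) : X → X → Set where
  here : ∀ {x} → Walk₂ a b x x
  viaA : ∀ {x y} → Walk₂ a b (a x) y → Walk₂ a b x y
  viaB : ∀ {x y} → Walk₂ a b (b x) y → Walk₂ a b x y

data Walk₃ {X : Set} (a b c : X → X) : X → X → Set where
  here : ∀ {x} → Walk₃ a b c x x
  viaA : ∀ {x y} → Walk₃ a b c (a x) y → Walk₃ a b c x y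
  viaB : ∀ {x y} → Walk₃ a b c (b x) y → Walk₃ a b c x y
  viaC : ∀ {x y} → Walk₃ a b c (c x) y → Walk₃ a b c x y

module _ {X : Set} {a b : X → X} where

  walk₂-reflexive : ∀ {x y} → x ≡ y → Walk₂ a b x y
  walk₂-reflexive refl = here

  walk₂-trans : ∀ {x y z} → Walk₂ a b x y → Walk₂ a b y z → Walk₂ a b x z
  walk₂-trans here     w = w
  walk₂-trans (viaA v) w = viaA (walk₂-trans v w)
  walk₂-trans (viaB v) w = viaB (walk₂-trans v w)

  walk₂-sym : (∀ x → a (a x) ≡ x) → (∀ x → b (b x) ≡ x) →
              ∀ {x y} → Walk₂ a b x y → Walk₂ a b y x
  walk₂-sym a-invol b-invol here = here
  walk₂-sym a-invol b-invol (viaA {x} w) =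
    walk₂-trans (walk₂-sym a-invol b-invol w) (viaA (walk₂-reflexive (a-invol x)))
  walk₂-sym a-invol b-invol (viaB {x} w) =
    walk₂-trans (walk₂-sym a-invol b-invol w) (viaB (walk₂-reflexive (b-invol x)))

module _ {X : Set} {a b c : X → X} where

  walk₃-reflexive : ∀ {x y} → x ≡ y → Walk₃ a b c x y
  walk₃-reflexive refl = here

  walk₃-trans : ∀ {x y z} → Walk₃ a b c x y → Walk₃ a b c y z → Walk₃ a b c x z
  walk₃-trans here     w = w
  walk₃-trans (viaA v) w = viaA (walk₃-trans v w)
  walk₃-trans (viaB v) w = viaB (walk₃-trans v w)
  walk₃-trans (viaC v) w = viaC (walk₃-trans v w)

  walk₃-sym : (∀ x → a (a x) ≡ x) → (∀ x → b (b x) ≡ x) → (∀ x → c (c x) ≡ x) →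
              ∀ {x y} → Walk₃ a b c x y → Walk₃ a b c y x
  walk₃-sym a-invol b-invol c-invol here = here
  walk₃-sym a-invol b-invol c-invol (viaA {x} w) =
    walk₃-trans (walk₃-sym a-invol b-invol c-invol w) (viaA (walk₃-reflexive (a-invol x)))
  walk₃-sym a-invol b-invol c-invol (viaB {x} w) =
    walk₃-trans (walk₃-sym a-invol b-invol c-invol w) (viaB (walk₃-reflexive (b-invol x)))
  walk₃-sym a-invol b-invol c-invol (viaC {x} w) =
    walk₃-trans (walk₃-sym a-invol b-invol c-invol w) (viaC (walk₃-reflexive (c-invol x)))

  walk₂⇒walk₃ : ∀ {x y} → Walk₂ b c x y → Walk₃ a b c x y
  walk₂⇒walk₃ here     = here
  walk₂⇒walk₃ (viaA w) = viaB (walk₂⇒walk₃ w)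
  walk₂⇒walk₃ (viaB w) = viaC (walk₂⇒walk₃ w)

module Conjugation {X : Set} {m : ℕ} (code : X ↔ Fin m) where

  open Inverse code using (to; from; strictlyInverseˡ; strictlyInverseʳ)

  conj : (X → X) → Fin m → Fin m
  conj σ = to ∘ σ ∘ from

  conj-to : ∀ σ x → conj σ (to x) ≡ to (σ x)
  conj-to σ x = cong (to ∘ σ) (strictlyInverseʳ x)

  conj-∘ : ∀ σ τ i → conj σ (conj τ i) ≡ conj (σ ∘ τ) i
  conj-∘ σ τ i = conj-to σ (τ (from i))

  conj-invol : ∀ σ → (∀ x → σ (σ x) ≡ x) → ∀ i → conj σ (conj σ i) ≡ i
  conj-invol σ σ-invol i =
    trans (conj-∘ σ σ i) (trans (cong to (σ-invol (from i))) (strictlyInverseˡ i))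

  conj-free : ∀ σ → (∀ x → σ x ≢ x) → ∀ i → conj σ i ≢ i
  conj-free σ σ-free i eq =
    σ-free (from i) (trans (sym (strictlyInverseʳ (σ (from i)))) (cong from eq))

  walk₂⇒orb2 : ∀ {a b x y} → Walk₂ a b x y → Orb2 (conj a) (conj b) (to x) (to y)
  walk₂⇒orb2 here = here
  walk₂⇒orb2 {a} {b} {y = y} (viaA {x} w) =
    viaA (subst (λ i → Orb2 (conj a) (conj b) i (to y)) (sym (conj-to a x)) (walk₂⇒orb2 w))
  walk₂⇒orb2 {a} {b} {y = y} (viaB {x} w) =
    viaB (subst (λ i → Orb2 (conj a) (conj b) i (to y)) (sym (conj-to b x)) (walk₂⇒orb2 w))

  walk₃⇒orb3 : ∀ {a b c x y} → Walk₃ a b c x y → Orb3 (conj a) (conj b) (conj c) (to x) (to y)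
  walk₃⇒orb3 here = here
  walk₃⇒orb3 {a} {b} {c} {y = y} (viaA {x} w) =
    viaA (subst (λ i → Orb3 (conj a) (conj b) (conj c) i (to y)) (sym (conj-to a x)) (walk₃⇒orb3 w))
  walk₃⇒orb3 {a} {b} {c} {y = y} (viaB {x} w) =
    viaB (subst (λ i → Orb3 (conj a) (conj b) (conj c) i (to y)) (sym (conj-to b x)) (walk₃⇒orb3 w))
  walk₃⇒orb3 {a} {b} {c} {y = y} (viaC {x} w) =
    viaC (subst (λ i → Orb3 (conj a) (conj b) (conj c) i (to y)) (sym (conj-to c x)) (walk₃⇒orb3 w))

  orbits-by-label : ∀ (a b : X → X) {r} (L : X → Fin r) (rep : Fin r → X) →
    (∀ x → a (a x) ≡ x) → (∀ x → b (b x) ≡ x) →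
    (∀ x → L (a x) ≡ L x) → (∀ x → L (b x) ≡ L x) →
    (∀ x → Walk₂ a b x (rep (L x))) →
    ∀ i j → (L (from i) ≡ L (from j) → Orb2 (conj a) (conj b) i j)
          × (Orb2 (conj a) (conj b) i j → L (from i) ≡ L (from j))
  orbits-by-label a b L rep a-invol b-invol L-a L-b toRep i j = same-label⇒orbit , orbit⇒same-label
    where
    same-label⇒orbit : L (from i) ≡ L (from j) → Orb2 (conj a) (conj b) i j
    same-label⇒orbit eq =
      subst₂ (Orb2 (conj a) (conj b)) (strictlyInverseˡ i) (strictlyInverseˡ j)
        (walk₂⇒orb2 (walk₂-trans (toRep (from i))
          (subst (λ v → Walk₂ a b (rep v) (from j)) (sym eq)
            (walk₂-sym a-invol b-invol (toRep (from j))))))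

    L-conj : ∀ σ → (∀ x → L (σ x) ≡ L x) → ∀ i → L (from (conj σ i)) ≡ L (from i)
    L-conj σ L-σ i = trans (cong L (strictlyInverseʳ (σ (from i)))) (L-σ (from i))

    orbit⇒same-label : ∀ {i j} → Orb2 (conj a) (conj b) i j → L (from i) ≡ L (from j)
    orbit⇒same-label here         = refl
    orbit⇒same-label (viaA {i} o) = trans (sym (L-conj a L-a i)) (orbit⇒same-label o)
    orbit⇒same-label (viaB {i} o) = trans (sym (L-conj b L-b i)) (orbit⇒same-label o)

record FlagSystem (X : Set) (E : ℕ) : Set where
  field
    σ₀ σ₁ σ₂ : X → X
    σ₀-invol : ∀ x → σ₀ (σ₀ x) ≡ x
    σ₁-invol : ∀ x → σ₁ (σ₁ x) ≡ x
    σ₂-invol : ∀ x → σ₂ (σ₂ x) ≡ x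
    σ₀-free : ∀ x → σ₀ x ≢ x
    σ₁-free : ∀ x → σ₁ x ≢ x
    σ₂-free : ∀ x → σ₂ x ≢ x
    σ₀σ₂-comm : ∀ x → σ₀ (σ₂ x) ≡ σ₂ (σ₀ x)
    σ₀σ₂-free : ∀ x → σ₀ (σ₂ x) ≢ x
    #vertices #faces : ℕ
    vertex : X → Fin #vertices
    edge   : X → Fin E
    face   : X → Fin #faces
    vertex-σ₁ : ∀ x → vertex (σ₁ x) ≡ vertex x
    vertex-σ₂ : ∀ x → vertex (σ₂ x) ≡ vertex x
    edge-σ₀   : ∀ x → edge (σ₀ x) ≡ edge x
    edge-σ₂   : ∀ x → edge (σ₂ x) ≡ edge x
    face-σ₀   : ∀ x → face (σ₀ x) ≡ face x
    face-σ₁   : ∀ x → face (σ₁ x) ≡ face x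
    vertexRep : Fin #vertices → X
    edgeRep   : Fin E → X
    faceRep   : Fin #faces → X
    vertex-vertexRep : ∀ v → vertex (vertexRep v) ≡ v
    edge-edgeRep     : ∀ e → edge (edgeRep e) ≡ e
    face-faceRep     : ∀ c → face (faceRep c) ≡ c
    walk-vertexRep : ∀ x → Walk₂ σ₁ σ₂ x (vertexRep (vertex x))
    walk-edgeRep   : ∀ x → Walk₂ σ₀ σ₂ x (edgeRep (edge x))
    walk-faceRep   : ∀ x → Walk₂ σ₀ σ₁ x (faceRep (face x))
    base : X
    walk-base : ∀ v → Walk₃ σ₀ σ₁ σ₂ (vertexRep v) base

module FlagSystemMap {X : Set} {E : ℕ} (F : FlagSystem X E) {m : ℕ} (code : X ↔ Fin m) where

  open FlagSystem F
  open Inverse code using (to; from; strictlyInverseˡ; strictlyInverseʳ)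
  open Conjugation code

  private
    walk-to-base : ∀ x → Walk₃ σ₀ σ₁ σ₂ x base
    walk-to-base x = walk₃-trans (walk₂⇒walk₃ (walk-vertexRep x)) (walk-base (vertex x))

    flags-connected : ∀ i j → Orb3 (conj σ₀) (conj σ₁) (conj σ₂) i j
    flags-connected i j =
      subst₂ (Orb3 (conj σ₀) (conj σ₁) (conj σ₂)) (strictlyInverseˡ i) (strictlyInverseˡ j)
        (walk₃⇒orb3 (walk₃-trans (walk-to-base (from i))
          (walk₃-sym σ₀-invol σ₁-invol σ₂-invol (walk-to-base (from j)))))

    label-surjective : ∀ {r} (L : X → Fin r) (rep : Fin r → X) → (∀ v → L (rep v) ≡ v) →
                  ∀ v → ∃ λ i → L (from i) ≡ v
    label-surjective L rep L-rep v = to (rep v) , trans (cong L (strictlyInverseʳ (rep v))) (L-rep v)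

  flagMap : Map E
  flagMap = record
    { m = m
    ; s0 = conj σ₀ ; s1 = conj σ₁ ; s2 = conj σ₂
    ; s0-inv = conj-invol σ₀ σ₀-invol
    ; s1-inv = conj-invol σ₁ σ₁-invol
    ; s2-inv = conj-invol σ₂ σ₂-invol
    ; s0-free = conj-free σ₀ σ₀-free
    ; s1-free = conj-free σ₁ σ₁-free
    ; s2-free = conj-free σ₂ σ₂-free
    ; s02-comm = λ i → trans (conj-∘ σ₀ σ₂ i)
        (trans (cong to (σ₀σ₂-comm (from i))) (sym (conj-∘ σ₂ σ₀ i)))
    ; s02-free = λ i eq → conj-free (σ₀ ∘ σ₂) σ₀σ₂-free i (trans (sym (conj-∘ σ₀ σ₂ i)) eq)
    ; connected = flags-connected
    ; nV = #vertices ; nF = #faces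
    ; vtx = vertex ∘ from ; edg = edge ∘ from ; fac = face ∘ from
    ; vtx-orb = orbits-by-label σ₁ σ₂ vertex vertexRep σ₁-invol σ₂-invol vertex-σ₁ vertex-σ₂ walk-vertexRep
    ; edg-orb = orbits-by-label σ₀ σ₂ edge edgeRep σ₀-invol σ₂-invol edge-σ₀ edge-σ₂ walk-edgeRep
    ; fac-orb = orbits-by-label σ₀ σ₁ face faceRep σ₀-invol σ₁-invol face-σ₀ face-σ₁ walk-faceRep
    ; vtx-surj = label-surjective vertex vertexRep vertex-vertexRep
    ; edg-surj = label-surjective edge edgeRep edge-edgeRep
    ; fac-surj = label-surjective face faceRep face-faceRep
    }

  incidences : ∀ {r} → (X → Fin r) → (X → X) → Fin r → ℕ
  incidences L σ v = ∑[ e < E ] ([ L (edgeRep e) ≟′ v ] + [ L (σ (edgeRep e)) ≟′ v ])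

  private
    deg≡incidences : ∀ {r} (L : X → Fin r) (σ : X → X) (v : Fin r) →
      sum (map (λ e → [ L (from (to (edgeRep e))) ≟′ v ] + [ L (from (conj σ (to (edgeRep e)))) ≟′ v ])
               (allFin E))
      ≡ incidences L σ v
    deg≡incidences L σ v = trans (sum-allFin {E} _) (sum-cong-≗ λ e →
      cong₂ (λ x y → [ L x ≟′ v ] + [ L y ≟′ v ])
        (strictlyInverseʳ (edgeRep e))
        (trans (strictlyInverseʳ (σ (from (to (edgeRep e))))) (cong σ (strictlyInverseʳ (edgeRep e)))))

  deg-mapGraph : ∀ v → deg (mapGraph flagMap) v ≡ incidences vertex σ₀ v
  deg-mapGraph = deg≡incidences vertex σ₀

  deg-dualGraph : ∀ c → deg (dualGraph flagMap) c ≡ incidences face σ₂ c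
  deg-dualGraph = deg≡incidences face σ₂

edgeIso-refl : ∀ {E} (G : Graph E) → EdgeIso G G
edgeIso-refl G = ↔-id (Fin (V G)) , λ _ → inj₁ refl

map-realizable : ∀ {E} (M : Map E) {d t : List ℕ} →
  degSeq (mapGraph M) ↭ d → degSeq (dualGraph M) ↭ t → Realizable d t
map-realizable {E} M degG degH =
  record { E = E ; G = mapGraph M ; H = dualGraph M } ,
  (M , edgeIso-refl (mapGraph M) , edgeIso-refl (dualGraph M)) ,
  degG , degH

module ChainMap (k : ℕ) where

  Edge : Set
  Edge = Fin 3 ⊎ Fin (suc k)

  pattern LU  = inj₁ 0F
  pattern LW  = inj₁ 1F
  pattern B   = inj₁ 2F
  pattern A i = inj₂ i

  edgeCode : Edge ↔ Fin (3 + suc k)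
  edgeCode = ↔-sym +↔⊎

  -- A flag (e , x , y) is the end x and the side y of the edge e. For B and the Aᵢ the end
  -- false lies at U, and the side false of Aᵢ faces Aᵢ₋₁ (the pentagon when i = 0).
  Flag : Set
  Flag = Edge × Bool × Bool

  flagCode : Flag ↔ Fin ((3 + suc k) * (2 * 2))
  flagCode = ↔-sym *↔× ↔-∘ (edgeCode ×-↔ (↔-sym *↔× ↔-∘ (↔-sym 2↔Bool ×-↔ ↔-sym 2↔Bool)))

  σ₀ σ₁ σ₂ : Flag → Flag
  σ₀ (e , x , y) = e , not x , y
  σ₂ (e , x , y) = e , x , not y

  σ₁-lowerA : Fin (suc k) → Bool → Flag
  σ₁-lowerA zero    false = LU , true , false
  σ₁-lowerA zero    true  = LW , true , false
  σ₁-lowerA (suc j) x     = A (inject₁ j) , x , true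

  σ₁-upperA : {i : Fin (suc k)} → View i → Bool → Flag
  σ₁-upperA ‵fromℕ       false = B , false , true
  σ₁-upperA ‵fromℕ       true  = LW , false , true
  σ₁-upperA (‵inject₁ j) x     = A (suc j) , x , false

  σ₁ (LU , false , false) = LU , true , true
  σ₁ (LU , true  , true ) = LU , false , false
  σ₁ (LU , false , true ) = B , false , false
  σ₁ (LU , true  , false) = A zero , false , false
  σ₁ (LW , false , false) = B , true , false
  σ₁ (LW , false , true ) = A (fromℕ k) , true , true
  σ₁ (LW , true  , false) = A zero , true , false
  σ₁ (LW , true  , true ) = B , true , true
  σ₁ (B  , false , false) = LU , false , true
  σ₁ (B  , false , true ) = A (fromℕ k) , false , true
  σ₁ (B  , true  , false) = LW , false , false
  σ₁ (B  , true  , true ) = LW , true , true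
  σ₁ (A i , x , false) = σ₁-lowerA i x
  σ₁ (A i , x , true ) = σ₁-upperA (view i) x

  σ₀-invol : ∀ p → σ₀ (σ₀ p) ≡ p
  σ₀-invol (e , x , y) = cong (λ x′ → e , x′ , y) (not-involutive x)

  σ₂-invol : ∀ p → σ₂ (σ₂ p) ≡ p
  σ₂-invol (e , x , y) = cong (λ y′ → e , x , y′) (not-involutive y)

  σ₁-invol : ∀ p → σ₁ (σ₁ p) ≡ p
  σ₁-invol (LU , false , false) = refl
  σ₁-invol (LU , true  , true ) = refl
  σ₁-invol (LU , false , true ) = refl
  σ₁-invol (LU , true  , false) = refl
  σ₁-invol (LW , false , false) = refl
  σ₁-invol (LW , false , true ) rewrite view-fromℕ k = refl
  σ₁-invol (LW , true  , false) = refl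
  σ₁-invol (LW , true  , true ) = refl
  σ₁-invol (B  , false , false) = refl
  σ₁-invol (B  , false , true ) rewrite view-fromℕ k = refl
  σ₁-invol (B  , true  , false) = refl
  σ₁-invol (B  , true  , true ) = refl
  σ₁-invol (A zero    , false , false) = refl
  σ₁-invol (A zero    , true  , false) = refl
  σ₁-invol (A (suc j) , x     , false) rewrite view-inject₁ j = refl
  σ₁-invol (A i , x , true) with view i
  ... | ‵fromℕ with x
  ...   | false = refl
  ...   | true  = refl
  σ₁-invol (A i , x , true) | ‵inject₁ j = refl

  σ₀-free : ∀ p → σ₀ p ≢ p
  σ₀-free (e , x , y) eq = not-¬ refl (sym (cong (proj₁ ∘ proj₂) eq))

  σ₂-free : ∀ p → σ₂ p ≢ p
  σ₂-free (e , x , y) eq = not-¬ refl (sym (cong (proj₂ ∘ proj₂) eq))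

  σ₀σ₂-free : ∀ p → σ₀ (σ₂ p) ≢ p
  σ₀σ₂-free (e , x , y) eq = not-¬ refl (sym (cong (proj₁ ∘ proj₂) eq))

  σ₁-free : ∀ p → σ₁ p ≢ p
  σ₁-free (LU , false , false) ()
  σ₁-free (LU , true  , true ) ()
  σ₁-free (LU , false , true ) ()
  σ₁-free (LU , true  , false) ()
  σ₁-free (LW , false , false) ()
  σ₁-free (LW , false , true ) ()
  σ₁-free (LW , true  , false) ()
  σ₁-free (LW , true  , true ) ()
  σ₁-free (B  , false , false) ()
  σ₁-free (B  , false , true ) ()
  σ₁-free (B  , true  , false) ()
  σ₁-free (B  , true  , true ) ()
  σ₁-free (A zero    , false , false) ()
  σ₁-free (A zero    , true  , false) ()
  σ₁-free (A (suc j) , x     , false) ()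
  σ₁-free (A i , x , true) with view i
  ... | ‵fromℕ with x
  ...   | false = λ ()
  ...   | true  = λ ()
  σ₁-free (A i , x , true) | ‵inject₁ j = λ ()

  pattern U = 0F
  pattern W = 1F

  endpoint : Bool → Fin 2
  endpoint false = U
  endpoint true  = W

  vertex : Flag → Fin 2
  vertex (LU  , _ , _) = U
  vertex (LW  , _ , _) = W
  vertex (B   , x , _) = endpoint x
  vertex (A _ , x , _) = endpoint x

  pattern pentagon = 0F
  pattern triangle = 1F
  pattern digon j  = suc (suc j)

  faceBelowA : Fin (suc k) → Fin (2 + k)
  faceBelowA zero    = pentagon
  faceBelowA (suc j) = digon j

  faceAboveA : {i : Fin (suc k)} → View i → Fin (2 + k)
  faceAboveA ‵fromℕ       = triangle
  faceAboveA (‵inject₁ j) = digon j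

  face : Flag → Fin (2 + k)
  face (LU  , _ , _    ) = pentagon
  face (LW  , _ , false) = pentagon
  face (LW  , _ , true ) = triangle
  face (B   , _ , false) = pentagon
  face (B   , _ , true ) = triangle
  face (A i , _ , false) = faceBelowA i
  face (A i , _ , true ) = faceAboveA (view i)

  edge : Flag → Fin (3 + suc k)
  edge = Inverse.to edgeCode ∘ proj₁

  vertex-σ₁ : ∀ p → vertex (σ₁ p) ≡ vertex p
  vertex-σ₁ (LU , false , false) = refl
  vertex-σ₁ (LU , true  , true ) = refl
  vertex-σ₁ (LU , false , true ) = refl
  vertex-σ₁ (LU , true  , false) = refl
  vertex-σ₁ (LW , false , false) = refl
  vertex-σ₁ (LW , false , true ) = refl
  vertex-σ₁ (LW , true  , false) = refl
  vertex-σ₁ (LW , true  , true ) = refl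
  vertex-σ₁ (B  , false , false) = refl
  vertex-σ₁ (B  , false , true ) = refl
  vertex-σ₁ (B  , true  , false) = refl
  vertex-σ₁ (B  , true  , true ) = refl
  vertex-σ₁ (A zero    , false , false) = refl
  vertex-σ₁ (A zero    , true  , false) = refl
  vertex-σ₁ (A (suc j) , x     , false) = refl
  vertex-σ₁ (A i , x , true) with view i
  ... | ‵fromℕ with x
  ...   | false = refl
  ...   | true  = refl
  vertex-σ₁ (A i , x , true) | ‵inject₁ j = refl

  vertex-σ₂ : ∀ p → vertex (σ₂ p) ≡ vertex p
  vertex-σ₂ (LU  , _ , _) = refl
  vertex-σ₂ (LW  , _ , _) = refl
  vertex-σ₂ (B   , _ , _) = refl
  vertex-σ₂ (A _ , _ , _) = refl

  face-σ₀ : ∀ p → face (σ₀ p) ≡ face p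
  face-σ₀ (LU  , _ , _    ) = refl
  face-σ₀ (LW  , _ , false) = refl
  face-σ₀ (LW  , _ , true ) = refl
  face-σ₀ (B   , _ , false) = refl
  face-σ₀ (B   , _ , true ) = refl
  face-σ₀ (A _ , _ , false) = refl
  face-σ₀ (A _ , _ , true ) = refl

  face-σ₁ : ∀ p → face (σ₁ p) ≡ face p
  face-σ₁ (LU , false , false) = refl
  face-σ₁ (LU , true  , true ) = refl
  face-σ₁ (LU , false , true ) = refl
  face-σ₁ (LU , true  , false) = refl
  face-σ₁ (LW , false , false) = refl
  face-σ₁ (LW , false , true ) rewrite view-fromℕ k = refl
  face-σ₁ (LW , true  , false) = refl
  face-σ₁ (LW , true  , true ) = refl
  face-σ₁ (B  , false , false) = refl
  face-σ₁ (B  , false , true ) rewrite view-fromℕ k = refl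
  face-σ₁ (B  , true  , false) = refl
  face-σ₁ (B  , true  , true ) = refl
  face-σ₁ (A zero    , false , false) = refl
  face-σ₁ (A zero    , true  , false) = refl
  face-σ₁ (A (suc j) , x     , false) rewrite view-inject₁ j = refl
  face-σ₁ (A i , x , true) with view i
  ... | ‵fromℕ with x
  ...   | false = refl
  ...   | true  = refl
  face-σ₁ (A i , x , true) | ‵inject₁ j = refl

  vertexRep : Fin 2 → Flag
  vertexRep U = LU , false , false
  vertexRep W = LW , false , false

  edgeRep : Fin (3 + suc k) → Flag
  edgeRep e = Inverse.from edgeCode e , false , false

  faceRep : Fin (2 + k) → Flag
  faceRep pentagon  = LU , false , false
  faceRep triangle  = LW , false , true
  faceRep (digon j) = A (suc j) , false , false

  vertex-vertexRep : ∀ v → vertex (vertexRep v) ≡ v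
  vertex-vertexRep U = refl
  vertex-vertexRep W = refl

  face-faceRep : ∀ c → face (faceRep c) ≡ c
  face-faceRep pentagon  = refl
  face-faceRep triangle  = refl
  face-faceRep (digon j) = refl

  walk-vertexRepA : ∀ i x y → Walk₂ σ₁ σ₂ (A i , x , y) (vertexRep (endpoint x))
  walk-vertexRepA = <-weakInduction (λ i → ∀ x y → Walk₂ σ₁ σ₂ (A i , x , y) (vertexRep (endpoint x)))
    first next
    where
    first : ∀ x y → Walk₂ σ₁ σ₂ (A zero , x , y) (vertexRep (endpoint x))
    first false false = viaA (viaB (viaA here))
    first false true  = viaB (viaA (viaB (viaA here)))
    first true  false = viaA (viaB (viaA (viaB (viaA here))))
    first true  true  = viaB (viaA (viaB (viaA (viaB (viaA here)))))
    next : ∀ j → (∀ x y → Walk₂ σ₁ σ₂ (A (inject₁ j) , x , y) (vertexRep (endpoint x))) →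
                  ∀ x y → Walk₂ σ₁ σ₂ (A (suc j) , x , y) (vertexRep (endpoint x))
    next j walk x false = viaA (walk x true)
    next j walk x true  = viaB (viaA (walk x true))

  walk-vertexRep : ∀ p → Walk₂ σ₁ σ₂ p (vertexRep (vertex p))
  walk-vertexRep (LU , false , false) = here
  walk-vertexRep (LU , true  , true ) = viaA here
  walk-vertexRep (LU , false , true ) = viaB here
  walk-vertexRep (LU , true  , false) = viaB (viaA here)
  walk-vertexRep (LW , false , false) = here
  walk-vertexRep (LW , true  , true ) = viaA (viaB (viaA here))
  walk-vertexRep (LW , false , true ) = viaB here
  walk-vertexRep (LW , true  , false) = viaB (viaA (viaB (viaA here)))
  walk-vertexRep (B  , false , false) = viaA (viaB here)
  walk-vertexRep (B  , false , true ) = viaB (viaA (viaB here))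
  walk-vertexRep (B  , true  , false) = viaA here
  walk-vertexRep (B  , true  , true ) = viaB (viaA here)
  walk-vertexRep (A i , x , y) = walk-vertexRepA i x y

  walk-edgeRep : ∀ p → Walk₂ σ₀ σ₂ p (edgeRep (edge p))
  walk-edgeRep (e , x , y) rewrite Inverse.strictlyInverseʳ edgeCode e = walk x y
    where
    walk : ∀ x y → Walk₂ σ₀ σ₂ (e , x , y) (e , false , false)
    walk false false = here
    walk true  false = viaA here
    walk false true  = viaB here
    walk true  true  = viaA (viaB here)

  σ₁-upperA-view : ∀ {i} (v : View i) x → σ₁ (A i , x , true) ≡ σ₁-upperA v x
  σ₁-upperA-view v x = cong (λ w → σ₁-upperA w x) (view-unique v)

  walk-faceRepUpperA : ∀ {i} (v : View i) x → Walk₂ σ₀ σ₁ (A i , x , true) (faceRep (faceAboveA v))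
  walk-faceRepUpperA v x =
    viaB (subst (λ p → Walk₂ σ₀ σ₁ p (faceRep (faceAboveA v))) (sym (σ₁-upperA-view v x)) (walk v x))
    where
    walk : ∀ {i} (v : View i) x → Walk₂ σ₀ σ₁ (σ₁-upperA v x) (faceRep (faceAboveA v))
    walk ‵fromℕ       false = viaA (viaB (viaA here))
    walk ‵fromℕ       true  = here
    walk (‵inject₁ j) false = here
    walk (‵inject₁ j) true  = viaA here

  walk-faceRep : ∀ p → Walk₂ σ₀ σ₁ p (faceRep (face p))
  walk-faceRep (LU , false , false) = here
  walk-faceRep (LU , true  , true ) = viaB here
  walk-faceRep (LU , false , true ) = viaA (viaB here)
  walk-faceRep (LU , true  , false) = viaA here
  walk-faceRep (LW , false , false) = viaB (viaA (viaB (viaA (viaB here))))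
  walk-faceRep (LW , true  , false) = viaA (viaB (viaA (viaB (viaA (viaB here)))))
  walk-faceRep (LW , false , true ) = here
  walk-faceRep (LW , true  , true ) = viaA here
  walk-faceRep (B  , false , false) = viaB (viaA (viaB here))
  walk-faceRep (B  , true  , false) = viaA (viaB (viaA (viaB here)))
  walk-faceRep (B  , true  , true ) = viaB (viaA here)
  walk-faceRep (B  , false , true ) = viaA (viaB (viaA here))
  walk-faceRep (A zero    , false , false) = viaB (viaA here)
  walk-faceRep (A zero    , true  , false) = viaA (viaB (viaA here))
  walk-faceRep (A (suc j) , false , false) = here
  walk-faceRep (A (suc j) , true  , false) = viaA here
  walk-faceRep (A i , x , true) = walk-faceRepUpperA (view i) x

  walk-base : ∀ v → Walk₃ σ₀ σ₁ σ₂ (vertexRep v) (vertexRep U)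
  walk-base U = here
  walk-base W = viaB (viaA (viaB (viaC here)))

  chainFlags : FlagSystem Flag (3 + suc k)
  chainFlags = record
    { σ₀ = σ₀ ; σ₁ = σ₁ ; σ₂ = σ₂
    ; σ₀-invol = σ₀-invol ; σ₁-invol = σ₁-invol ; σ₂-invol = σ₂-invol
    ; σ₀-free = σ₀-free ; σ₁-free = σ₁-free ; σ₂-free = σ₂-free
    ; σ₀σ₂-comm = λ _ → refl
    ; σ₀σ₂-free = σ₀σ₂-free
    ; #vertices = 2 ; #faces = 2 + k
    ; vertex = vertex ; edge = edge ; face = face
    ; vertex-σ₁ = vertex-σ₁ ; vertex-σ₂ = vertex-σ₂
    ; edge-σ₀ = λ _ → refl ; edge-σ₂ = λ _ → refl
    ; face-σ₀ = face-σ₀ ; face-σ₁ = face-σ₁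
    ; vertexRep = vertexRep ; edgeRep = edgeRep ; faceRep = faceRep
    ; vertex-vertexRep = vertex-vertexRep
    ; edge-edgeRep = Inverse.strictlyInverseˡ edgeCode
    ; face-faceRep = face-faceRep
    ; walk-vertexRep = walk-vertexRep ; walk-edgeRep = walk-edgeRep ; walk-faceRep = walk-faceRep
    ; base = vertexRep U
    ; walk-base = walk-base
    }

  open FlagSystemMap chainFlags flagCode using (flagMap; incidences; deg-mapGraph; deg-dualGraph)

  chainMap : Map (4 + k)
  chainMap = flagMap

  vertex-incidences : ∀ v → incidences vertex σ₀ v ≡ 4 + k
  vertex-incidences U = cong (3 +_) (∑-ones (suc k))
  vertex-incidences W = cong (3 +_) (∑-ones (suc k))

  digons : Fin (2 + k) → ℕ
  digons c = ∑[ j < k ] [ digon j ≟′ c ]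

  chain-incidences : ∀ c →
    ∑[ i < suc k ] ([ faceBelowA i ≟′ c ] + [ faceAboveA (view i) ≟′ c ])
    ≡ ([ pentagon ≟′ c ] + digons c) + (digons c + [ triangle ≟′ c ])
  chain-incidences c = begin
    ∑[ i < suc k ] ([ faceBelowA i ≟′ c ] + [ faceAboveA (view i) ≟′ c ])
      ≡⟨ ∑-distrib-+ (λ i → [ faceBelowA i ≟′ c ]) (λ i → [ faceAboveA (view i) ≟′ c ]) ⟩
    ([ pentagon ≟′ c ] + digons c) + ∑[ i < suc k ] [ faceAboveA (view i) ≟′ c ]
      ≡⟨ cong (([ pentagon ≟′ c ] + digons c) +_) (sum-init-last (λ i → [ faceAboveA (view i) ≟′ c ])) ⟩
    ([ pentagon ≟′ c ] + digons c)
      + (∑[ j < k ] [ faceAboveA (view (inject₁ j)) ≟′ c ] + [ faceAboveA (view (fromℕ k)) ≟′ c ])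
      ≡⟨ cong (λ s → ([ pentagon ≟′ c ] + digons c) + s)
           (cong₂ _+_ (sum-cong-≗ (λ j → cong (λ w → [ faceAboveA w ≟′ c ]) (view-inject₁ j)))
                      (cong (λ w → [ faceAboveA w ≟′ c ]) (view-fromℕ k))) ⟩
    ([ pentagon ≟′ c ] + digons c) + (digons c + [ triangle ≟′ c ]) ∎
    where open ≡-Reasoning

  faceDegree : Fin (2 + k) → ℕ
  faceDegree pentagon  = 5
  faceDegree triangle  = 3
  faceDegree (digon _) = 2

  -- Apart from the Aᵢ, the pentagon meets LU twice and LW and B once; the triangle meets LW and B.
  face-incidences : ∀ c → incidences face σ₂ c ≡ faceDegree c
  face-incidences pentagon =
    cong (4 +_) (trans (chain-incidences pentagon) (cong (λ d → (1 + d) + (d + 0)) (sum-replicate-zero k)))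
  face-incidences triangle =
    cong (2 +_) (trans (chain-incidences triangle) (cong (λ d → (0 + d) + (d + 1)) (sum-replicate-zero k)))
  face-incidences (digon j) =
    trans (chain-incidences (digon j)) (cong (λ d → (0 + d) + (d + 0)) (∑-indicator j))

  degSeq-graph : degSeq (mapGraph chainMap) ≡ 4 + k ∷ 4 + k ∷ []
  degSeq-graph = cong₂ (λ d d′ → d ∷ d′ ∷ [])
    (trans (deg-mapGraph U) (vertex-incidences U))
    (trans (deg-mapGraph W) (vertex-incidences W))

  degSeq-dual : degSeq (dualGraph chainMap) ≡ 5 ∷ 3 ∷ replicate k 2
  degSeq-dual = begin
    map (deg (dualGraph chainMap)) (allFin (2 + k))
      ≡⟨ map-cong (λ c → trans (deg-dualGraph c) (face-incidences c)) (allFin (2 + k)) ⟩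
    map faceDegree (allFin (2 + k))
      ≡⟨ map-tabulate id faceDegree ⟩
    5 ∷ 3 ∷ tabulate {n = k} (λ _ → 2)
      ≡⟨ cong (λ ds → 5 ∷ 3 ∷ ds) (tabulate-const k 2) ⟩
    5 ∷ 3 ∷ replicate k 2 ∎
    where open ≡-Reasoning

proposition5p1 : (n : ℕ) → 4 ≤ n →
    Realizable (n ∷ n ∷ []) (5 ∷ 3 ∷ replicate (n ∸ 4) 2)
proposition5p1 (suc (suc (suc (suc k)))) (s≤s (s≤s (s≤s (s≤s z≤n)))) =
  map-realizable (chainMap k) (↭-reflexive (degSeq-graph k)) (↭-reflexive (degSeq-dual k))
  where open ChainMap
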